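{- Let $q=p^r$ be a prime power with $p$ odd, $p\ne 3$, and $q\ne 5$. Define $h:(\mathbb{Z}/q\mathbb{Z})^\times\to\mathbb{N}$ by $h(a)=\lfloor 3a/q\rfloor$, with $a$ its representative in $\{1,\dots,q-1\}$. There does not exist a function $g:(\mathbb{Z}/q\mathbb{Z})^\times\to\{0,1\}$ such that both (i) $g(a)+g(-a)=1$ for all $a\in(\mathbb{Z}/q\mathbb{Z})^\times$, and (ii) $h=g+g\circ\theta_s$ for some $s\in(\mathbb{Z}/q\mathbb{Z})^\times$, where $\theta_s$ is multiplication by $s$. -}

module Defs where

open import Data.Nat using (ℕ; _<_; _≤_; _*_; _+_; _∸_; _^_; _%_; _/_; NonZero)
open import Data.Nat.Coprimality using (Coprime)
open import Data.Nat.Primality using (Prime)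
open import Data.Nat.Divisibility using (_∤_)
open import Data.Product using (_×_; ∃-syntax)
open import Relation.Binary.PropositionalEquality using (_≡_; _≢_)

-- a represents a unit of ℤ/qℤ : 1 ≤ a < q and gcd(a,q) = 1
IsUnit : ℕ → ℕ → Set
IsUnit q a = 1 ≤ a × a < q × Coprime a q

IsAdmissiblePrimePower : ℕ → Set
IsAdmissiblePrimePower q =
  ∃[ p ] ∃[ r ] (Prime p × 2 ∤ p × p ≢ 3 × 1 ≤ r × q ≡ p ^ r)

-- representative of -a in {1,…,q-1}
neg : ℕ → ℕ → ℕ
neg q a = q ∸ a

θ : (q : ℕ) → .{{NonZero q}} → ℕ → ℕ → ℕ
θ q s a = (s * a) % q

h : (q : ℕ) → .{{NonZero q}} → ℕ → ℕ
h q a = (3 * a) / q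

open import Data.Bool using (Bool; true; false)

-- the value of g : units → {0,1}, encoded as a Bool
bit : Bool → ℕ
bit false = 0
bit true  = 1

{-# OPTIONS --safe #-}
-- Call a unit a small, middle or large as h(a) = 0, 1, 2, i.e. as 3a lies below q, between q
-- and 2q, or above 2q, and write θ for multiplication by s. As g is {0,1}-valued, h = g + g ∘ θ
-- forces g = 0 at a small a and at θ a, and g = 1 at a large a: so θ never sends a small unit
-- to a large one, and it changes the value of g at every middle unit. For s = 1 the middle
-- unit (q − 1)/2 is fixed. For s = 2 and s = (q + 1)/2 the units k = ⌊q/3⌋, 2k, 4k − q form a
-- θ-path small → middle → small (in one direction or the other), along which g vanishes at
-- the middle unit and at its image, yet must differ there. For 2q ≤ 3s, resp. q ≤ 3s with
-- 2s < q, the small unit 1, resp. 2, has a large image. In the two remaining ranges, 3 ≤ s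
-- with 3s < q and s > (q + 1)/2 with 3s < 2q, walk along the multipliers 1, 2, 3, … with
-- images s, 2s, 3s, …, resp. along 1, 3, 5, … with images s, s + t, s + 2t, … where
-- t = 2s − q: these images cross 2q/3 in steps small enough that the multiplier is still below
-- q/3, and of two consecutive multipliers one is prime to p, which again gives a small unit
-- with a large image.
module Submission where

open import Defs
open import Data.Bool using (Bool; true; false)
open import Data.Empty using (⊥)
open import Data.List using (_∷_; [])
open import Data.Nat
open import Data.Nat.Coprimality using (Coprime; coprime-divisor)
open import Data.Nat.DivMod
open import Data.Nat.Divisibility
open import Data.Nat.Primality using (Prime; euclidsLemma; prime⇒irreducible; prime⇒nonTrivial)
open import Data.Nat.Properties
open import Data.Nat.Tactic.RingSolver using (solve)
open import Data.Product using (_×_; _,_; proj₁; proj₂; ∃-syntax; Σ-syntax)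
open import Data.Sum using (inj₁; inj₂)
open import Function using (_∘_)
open import Relation.Nullary using (¬_; yes; no; contradiction)
open import Relation.Nullary.Decidable using (from-no)
open import Relation.Unary using (Decidable)
open import Relation.Binary.PropositionalEquality

bits≡0 : ∀ {x y} → bit x + bit y ≡ 0 → x ≡ false × y ≡ false
bits≡0 {false} {false} _ = refl , refl
bits≡0 {false} {true}  ()
bits≡0 {true}          ()

bits≡2 : ∀ {x y} → bit x + bit y ≡ 2 → x ≡ true × y ≡ true
bits≡2 {true}  {true}  _ = refl , refl
bits≡2 {true}  {false} ()
bits≡2 {false} {true}  ()
bits≡2 {false} {false} ()

bits≡1⇒≢ : ∀ {x y} → bit x + bit y ≡ 1 → x ≢ y
bits≡1⇒≢ {false} {false} ()
bits≡1⇒≢ {true}  {true}  ()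
bits≡1⇒≢ {false} {true}  _ ()
bits≡1⇒≢ {true}  {false} _ ()

boundary : ∀ {P : ℕ → Set} → Decidable P → ∀ n → P 0 → ¬ P n → ∃[ j ] (P j × ¬ P (suc j))
boundary P? zero    p₀ ¬pₙ = contradiction p₀ ¬pₙ
boundary P? (suc n) p₀ ¬pₙ₊₁ with P? n
... | yes pₙ = n , pₙ , ¬pₙ₊₁
... | no ¬pₙ = boundary P? n p₀ ¬pₙ

≤-by : ∀ {m n} o → m + o ≡ n → m ≤ n
≤-by {m} o m+o≡n = subst (m ≤_) m+o≡n (m≤m+n m o)

/-unique : ∀ {m n} k .{{_ : NonZero n}} → k * n ≤ m → m < suc k * n → m / n ≡ k
/-unique {m} {n} k kn≤m m<[1+k]n =
  ≤-antisym (s≤s⁻¹ (m<n*o⇒m/o<n m<[1+k]n)) (subst (_≤ m / n) (m*n/n≡m k n) (/-monoˡ-≤ n kn≤m))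

%-of-≡ : ∀ {m r} l {n} .{{_ : NonZero n}} → m ≡ r + l * n → r < n → m % n ≡ r
%-of-≡ {m} {r} l {n} m≡r+ln r<n = begin
  m % n            ≡⟨ cong (_% n) m≡r+ln ⟩
  (r + l * n) % n  ≡⟨ [m+kn]%n≡m%n r l n ⟩
  r % n            ≡⟨ m<n⇒m%n≡m r<n ⟩
  r                ∎
  where open ≡-Reasoning

division-with-remainder : ∀ n d .{{_ : NonZero d}} → ¬ d ∣ n →
  ∃[ k ] ∃[ e ] (n ≡ e + d * k × 0 < e × e < d)
division-with-remainder n d d∤n =
  n / d , n % d , trans (m≡m%n+[m/n]*n n d) (cong (n % d +_) (*-comm (n / d) d)) ,
  n≢0⇒n>0 (d∤n ∘ m%n≡0⇒n∣m n d) , m%n<n n d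

remainder<quotient : ∀ {n e} k → n ≡ e + 3 * k → e ≤ 2 → 7 ≤ n → ¬ 2 ∣ n → e < k
remainder<quotient (suc (suc (suc k))) _ e≤2 _ _ = s≤s (≤-trans e≤2 (s≤s (s≤s z≤n)))
remainder<quotient 2 _    z≤n               _ _   = s≤s z≤n
remainder<quotient 2 _    (s≤s z≤n)         _ _   = s≤s (s≤s z≤n)
remainder<quotient 2 refl (s≤s (s≤s z≤n))   _ 2∤8 = contradiction (divides 4 refl) 2∤8
remainder<quotient 1 refl e≤2 7≤n _ = contradiction (≤-trans 7≤n (+-monoˡ-≤ 3 e≤2)) (from-no (7 ≤? 5))
remainder<quotient 0 refl e≤2 7≤n _ = contradiction (≤-trans 7≤n (+-monoˡ-≤ 0 e≤2)) (from-no (7 ≤? 2))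

h≡0 : ∀ {q a} .{{_ : NonZero q}} → 3 * a < q → h q a ≡ 0
h≡0 = m<n⇒m/n≡0

h≡1 : ∀ {q a} .{{_ : NonZero q}} → q ≤ 3 * a → 3 * a < 2 * q → h q a ≡ 1
h≡1 {q} q≤3a = /-unique 1 (subst (_≤ _) (sym (*-identityˡ q)) q≤3a)

h≡2 : ∀ {q a} .{{_ : NonZero q}} → 2 * q ≤ 3 * a → a < q → h q a ≡ 2
h≡2 2q≤3a a<q = /-unique 2 2q≤3a (*-monoʳ-< 3 a<q)

prime∤⇒coprime : ∀ {p a} → Prime p → ¬ p ∣ a → Coprime a p
prime∤⇒coprime p-prime p∤a (d∣a , d∣p) with prime⇒irreducible p-prime d∣p
... | inj₁ d≡1 = d≡1
... | inj₂ refl = contradiction d∣a p∤a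

coprime-* : ∀ {a m n} → Coprime a m → Coprime a n → Coprime a (m * n)
coprime-* {a} {m} a⊥m a⊥n {d} (d∣a , d∣mn) = a⊥n (d∣a , coprime-divisor d⊥m d∣mn)
  where
  d⊥m : Coprime d m
  d⊥m (e∣d , e∣m) = a⊥m (∣-trans e∣d d∣a , e∣m)

coprime-^ : ∀ {a p} r → Coprime a p → Coprime a (p ^ r)
coprime-^ zero    _   (_ , d∣1) = ∣1⇒≡1 d∣1
coprime-^ (suc r) a⊥p = coprime-* a⊥p (coprime-^ r a⊥p)

m∣m^n : ∀ {m n} → 0 < n → m ∣ m ^ n
m∣m^n {m} {suc n} _ = m∣m*n (m ^ n)

module _ {q s : ℕ} (3≤s : 3 ≤ s) (3s<q : 3 * s < q) where

  as<q⇒3a<q : ∀ a → a * s < q → 3 * (a * 1) < q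
  as<q⇒3a<q a as<q = begin-strict
    3 * (a * 1)  ≡⟨ cong (3 *_) (*-identityʳ a) ⟩
    3 * a        ≤⟨ *-monoˡ-≤ a 3≤s ⟩
    s * a        ≡⟨ *-comm s a ⟩
    a * s        <⟨ as<q ⟩
    q            ∎
    where open ≤-Reasoning

  multiples-next : ∀ j → 3 * (j * s) < 2 * q → suc j * s < q × 3 * (suc j * 1) < q
  multiples-next j below = v<q , as<q⇒3a<q (suc j) v<q
    where
    open ≤-Reasoning
    v<q : suc j * s < q
    v<q = *-cancelˡ-< 3 _ _ (begin-strict
      3 * (s + j * s)      ≡⟨ *-distribˡ-+ 3 s (j * s) ⟩
      3 * s + 3 * (j * s)  <⟨ +-mono-< 3s<q below ⟩
      q + 2 * q            ≡⟨ solve (q ∷ []) ⟩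
      3 * q                ∎)

  multiples-next-next : ∀ j → 3 * (j * s) < 2 * q → 5 ≤ suc j * 1 →
    suc (suc j) * s < q × 3 * (suc (suc j) * 1) < q
  multiples-next-next j below 5≤j+1 = v<q , as<q⇒3a<q (suc (suc j)) v<q
    where
    open ≤-Reasoning
    4≤j : 4 ≤ j
    4≤j = s≤s⁻¹ (subst (5 ≤_) (*-identityʳ (suc j)) 5≤j+1)
    6s<q : 6 * s < q
    6s<q = *-cancelˡ-< 2 _ _ (begin-strict
      2 * (6 * s)  ≡⟨ solve (s ∷ []) ⟩
      3 * (4 * s)  ≤⟨ *-monoʳ-≤ 3 (*-monoˡ-≤ s 4≤j) ⟩
      3 * (j * s)  <⟨ below ⟩
      2 * q        ∎)
    v<q : suc (suc j) * s < q
    v<q = *-cancelˡ-< 3 _ _ (begin-strict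
      3 * (s + (s + j * s))  ≡⟨ solve (s ∷ j ∷ []) ⟩
      6 * s + 3 * (j * s)    <⟨ +-mono-< 6s<q below ⟩
      q + 2 * q              ≡⟨ solve (q ∷ []) ⟩
      3 * q                  ∎)

module _ {q s t : ℕ} (3≤t : 3 ≤ t) (s*2≡t+q : s * 2 ≡ t + 1 * q) where

  odd-walk-room : ∀ j → 3 * (s + j * t) < 2 * q → 3 * t + 6 * (j * t) < q
  odd-walk-room j below = +-cancelˡ-< (3 * q) _ _ (begin-strict
    3 * q + (3 * t + 6 * (j * t))  ≡⟨ solve (q ∷ t ∷ j ∷ []) ⟩
    3 * (t + 1 * q) + 6 * (j * t)  ≡⟨ cong (λ v → 3 * v + 6 * (j * t)) s*2≡t+q ⟨
    3 * (s * 2) + 6 * (j * t)      ≡⟨ solve (s ∷ j ∷ t ∷ []) ⟩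
    2 * (3 * (s + j * t))          <⟨ *-monoʳ-< 2 below ⟩
    2 * (2 * q)                    ≡⟨ solve (q ∷ []) ⟩
    3 * q + q                      ∎)
    where open ≤-Reasoning

  odd-walk-value : ∀ i → t + 2 * (i * t) < q → s + i * t < q
  odd-walk-value i room = *-cancelˡ-< 2 _ _ (begin-strict
    2 * (s + i * t)          ≡⟨ solve (s ∷ i ∷ t ∷ []) ⟩
    s * 2 + 2 * (i * t)      ≡⟨ cong (_+ 2 * (i * t)) s*2≡t+q ⟩
    t + 1 * q + 2 * (i * t)  ≡⟨ solve (t ∷ q ∷ i ∷ []) ⟩
    q + (t + 2 * (i * t))    <⟨ +-monoʳ-< q room ⟩
    q + q                    ≡⟨ solve (q ∷ []) ⟩
    2 * q                    ∎)
    where open ≤-Reasoning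

  odd-walk-next : ∀ j → 3 * (s + j * t) < 2 * q → s + suc j * t < q × 3 * (1 + suc j * 2) < q
  odd-walk-next j below = odd-walk-value (suc j) (≤-<-trans value≤room room) , ≤-<-trans multiplier≤room room
    where
    open ≤-Reasoning
    room : 3 * t + 6 * (j * t) < q
    room = odd-walk-room j below
    value≤room : t + 2 * (suc j * t) ≤ 3 * t + 6 * (j * t)
    value≤room = ≤-by (4 * (j * t)) (solve (t ∷ j ∷ []))
    multiplier≤room : 3 * (1 + suc j * 2) ≤ 3 * t + 6 * (j * t)
    multiplier≤room = begin
      3 * (1 + suc j * 2)    ≡⟨ solve (j ∷ []) ⟩
      3 * 3 + 6 * (j * 1)    ≤⟨ +-mono-≤ (*-monoʳ-≤ 3 3≤t)
                                          (*-monoʳ-≤ 6 (*-monoʳ-≤ j (≤-trans (s≤s z≤n) 3≤t))) ⟩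
      3 * t + 6 * (j * t)    ∎

  odd-walk-next-next : ∀ j → 3 * (s + j * t) < 2 * q → 5 ≤ 1 + suc j * 2 →
    s + suc (suc j) * t < q × 3 * (1 + suc (suc j) * 2) < q
  odd-walk-next-next zero _ (s≤s (s≤s (s≤s ())))
  odd-walk-next-next (suc i) below _ =
    odd-walk-value (3 + i) (≤-<-trans value≤room room) , ≤-<-trans multiplier≤room room
    where
    open ≤-Reasoning
    room : 3 * t + 6 * ((1 + i) * t) < q
    room = odd-walk-room (suc i) below
    value≤room : t + 2 * ((3 + i) * t) ≤ 3 * t + 6 * ((1 + i) * t)
    value≤room = ≤-by (2 * t + 4 * (i * t)) (solve (t ∷ i ∷ []))
    multiplier≤room : 3 * (1 + (3 + i) * 2) ≤ 3 * t + 6 * ((1 + i) * t)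
    multiplier≤room = begin
      3 * (1 + (3 + i) * 2)          ≤⟨ ≤-by (6 + 12 * i) (solve (i ∷ [])) ⟩
      3 * 3 + 6 * ((1 + i) * 3)      ≤⟨ +-mono-≤ (*-monoʳ-≤ 3 3≤t) (*-monoʳ-≤ 6 (*-monoʳ-≤ (1 + i) 3≤t)) ⟩
      3 * t + 6 * ((1 + i) * t)      ∎

half-is-middle : ∀ {q m} → q ≡ 1 + 2 * m → 3 ≤ q → q ≤ 3 * m × 3 * m < 2 * q
half-is-middle {m = zero}  refl (s≤s ())
half-is-middle {m = suc m} refl _ = ≤-by m (solve (m ∷ [])) , ≤-by (2 + m) (solve (m ∷ []))

above-half : ∀ {q s m} → q ≡ 1 + 2 * m → q ≤ s * 2 → s ≢ suc m →
  ∃[ t ] (3 ≤ t × s * 2 ≡ t + 1 * q)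
above-half {s = s} {m} refl 1+2m≤2s s≢1+m
  with m≤n⇒∃[o]m+o≡n (*-cancelˡ-< 2 m s (subst (2 * m <_) (*-comm s 2) 1+2m≤2s))
... | zero  , 1+m+0≡s = contradiction (trans (sym 1+m+0≡s) (+-identityʳ (suc m))) s≢1+m
... | suc u , refl = 3 + 2 * u , s≤s (s≤s (s≤s z≤n)) , solve (m ∷ u ∷ [])

halving-double : ∀ {q s m} k → q ≡ 1 + 2 * m → s ≡ suc m → s * (2 * k) ≡ k + k * q
halving-double {m = m} k refl refl = solve (m ∷ k ∷ [])

halving-shift : ∀ {q s m k c} → q ≡ 1 + 2 * m → s ≡ suc m → 4 * k ≡ c + q →
  s * c + s * q ≡ 2 * k + 2 * k * q
halving-shift {q} {s} {m} {k} {c} refl refl 4k≡c+q = begin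
  s * c + s * q  ≡⟨ *-distribˡ-+ s c q ⟨
  s * (c + q)    ≡⟨ cong (s *_) 4k≡c+q ⟨
  s * (4 * k)    ≡⟨ solve (m ∷ k ∷ []) ⟩
  2 * k + 2 * k * q ∎
  where open ≡-Reasoning

module _ (q p : ℕ) .{{_ : NonZero q}} (p-prime : Prime p) (5≤p : 5 ≤ p) (p∣q : p ∣ q)
         (coprime : ∀ {a} → ¬ p ∣ a → Coprime a q) (q≢5 : q ≢ 5)
         (g : ℕ → Bool) (s : ℕ) (p∤s : ¬ p ∣ s) (s<q : s < q)
         (split : (a : ℕ) → IsUnit q a → h q a ≡ bit (g a) + bit (g (θ q s a)))
  where

  p∣⇒5≤ : ∀ {a} → 0 < a → p ∣ a → 5 ≤ a
  p∣⇒5≤ 0<a p∣a = ≤-trans 5≤p (∣⇒≤ {{>-nonZero 0<a}} p∣a)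

  p∤small : ∀ {a} → 0 < a → a < 5 → ¬ p ∣ a
  p∤small 0<a a<5 = <⇒≱ a<5 ∘ p∣⇒5≤ 0<a

  p∤1 : ¬ p ∣ 1
  p∤1 = p∤small z<s (s≤s (s≤s z≤n))

  p∤2 : ¬ p ∣ 2
  p∤2 = p∤small z<s (s≤s (s≤s (s≤s z≤n)))

  p∤3 : ¬ p ∣ 3
  p∤3 = p∤small z<s (s≤s (s≤s (s≤s (s≤s z≤n))))

  p∤4 : ¬ p ∣ 4
  p∤4 = p∤small z<s (s≤s (s≤s (s≤s (s≤s (s≤s z≤n)))))

  p∤⇒0< : ∀ {a} → ¬ p ∣ a → 0 < a
  p∤⇒0< {zero}  p∤0 = contradiction (p ∣0) p∤0
  p∤⇒0< {suc _} _   = z<s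

  2∤q : ¬ 2 ∣ q
  2∤q 2∣q with coprime p∤2 (∣-refl , 2∣q)
  ... | ()

  3∤q : ¬ 3 ∣ q
  3∤q 3∣q with coprime p∤3 (∣-refl , 3∣q)
  ... | ()

  7≤q : 7 ≤ q
  7≤q = ≤∧≢⇒< (≤∧≢⇒< (≤-trans 5≤p (∣⇒≤ p∣q)) (q≢5 ∘ sym))
               (λ 6≡q → 2∤q (subst (2 ∣_) 6≡q (divides 3 refl)))

  q-odd : ∃[ m ] q ≡ 1 + 2 * m
  q-odd with division-with-remainder q 2 2∤q
  ... | m , 1 , q≡1+2m , _ , _ = m , q≡1+2m
  ... | _ , zero , _ , () , _
  ... | _ , suc (suc _) , _ , _ , s≤s (s≤s ())

  m : ℕ
  m = proj₁ q-odd

  q≡1+2m : q ≡ 1 + 2 * m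
  q≡1+2m = proj₂ q-odd

  θ<q : ∀ a → θ q s a < q
  θ<q a = m%n<n (s * a) q

  θ-≡ : ∀ {a v} l → s * a ≡ v + l * q → v < q → θ q s a ≡ v
  θ-≡ l = %-of-≡ l

  p∤θ : ∀ {a} → ¬ p ∣ a → ¬ p ∣ θ q s a
  p∤θ {a} p∤a p∣θ with euclidsLemma s a p-prime (∣n∣m%n⇒∣m p∣q p∣θ)
  ... | inj₁ p∣s = p∤s p∣s
  ... | inj₂ p∣a = p∤a p∣a

  split-at : ∀ {a n} → ¬ p ∣ a → a < q → h q a ≡ n → bit (g a) + bit (g (θ q s a)) ≡ n
  split-at {a} p∤a a<q = trans (sym (split a (p∤⇒0< p∤a , a<q , coprime p∤a)))

  3a<q⇒a<q : ∀ a → 3 * a < q → a < q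
  3a<q⇒a<q a = ≤-<-trans (m≤n*m a 3)

  3a<2q⇒a<q : ∀ a → 3 * a < 2 * q → a < q
  3a<2q⇒a<q a 3a<2q = *-cancelˡ-< 3 a q (<-≤-trans 3a<2q (*-monoˡ-≤ q {2} {3} (s≤s (s≤s z≤n))))

  g-small : ∀ {a} → ¬ p ∣ a → 3 * a < q → g a ≡ false × g (θ q s a) ≡ false
  g-small {a} p∤a 3a<q = bits≡0 (split-at p∤a (3a<q⇒a<q a 3a<q) (h≡0 {q} {a} 3a<q))

  g-middle : ∀ {a} → ¬ p ∣ a → q ≤ 3 * a → 3 * a < 2 * q → g a ≢ g (θ q s a)
  g-middle {a} p∤a q≤3a 3a<2q = bits≡1⇒≢ (split-at p∤a (3a<2q⇒a<q a 3a<2q) (h≡1 {q} {a} q≤3a 3a<2q))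

  g-large : ∀ {a} → ¬ p ∣ a → 2 * q ≤ 3 * a → a < q → g a ≡ true
  g-large {a} p∤a 2q≤3a a<q = proj₁ (bits≡2 (split-at p∤a a<q (h≡2 {q} {a} 2q≤3a a<q)))

  small↛large : ∀ {a} → ¬ p ∣ a → 3 * a < q → ¬ (2 * q ≤ 3 * θ q s a)
  small↛large {a} p∤a 3a<q large
    with trans (sym (proj₂ (g-small p∤a 3a<q))) (g-large (p∤θ p∤a) large (θ<q a))
  ... | ()

  no-fixed-middle : ∀ {y} → ¬ p ∣ y → θ q s y ≡ y → q ≤ 3 * y → 3 * y < 2 * q → ⊥
  no-fixed-middle p∤y θy≡y q≤3y 3y<2q = g-middle p∤y q≤3y 3y<2q (cong g (sym θy≡y))

  no-0-1-0-path : ∀ {x y z} → ¬ p ∣ x → θ q s x ≡ y → θ q s y ≡ z →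
    3 * x < q → q ≤ 3 * y → 3 * y < 2 * q → 3 * z < q → ⊥
  no-0-1-0-path p∤x refl refl 3x<q q≤3y 3y<2q 3z<q =
    g-middle (p∤θ p∤x) q≤3y 3y<2q
      (trans (proj₂ (g-small p∤x 3x<q)) (sym (proj₁ (g-small (p∤θ (p∤θ p∤x)) 3z<q))))

  -- Multipliers a₀ + jδ whose images under θ are x + jd while these stay below q. Where the
  -- images cross 2q/3, `next` and `next-next` bound the next one or two images and multipliers;
  -- the second is needed only when p divides the first multiplier.
  record Walk : Set where
    field
      a₀ δ x d e : ℕ
      s*a₀≡x   : s * a₀ ≡ x
      s*δ≡d+eq : s * δ ≡ d + e * q
      p∤δ      : ¬ p ∣ δ
      0<d      : 0 < d
      starts-below : 3 * x < 2 * q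
      next : ∀ j → 3 * (x + j * d) < 2 * q → x + suc j * d < q × 3 * (a₀ + suc j * δ) < q
      next-next : ∀ j → 3 * (x + j * d) < 2 * q → 5 ≤ a₀ + suc j * δ →
                  x + suc (suc j) * d < q × 3 * (a₀ + suc (suc j) * δ) < q

  module _ (w : Walk) where
    open Walk w

    θ-walk : ∀ j → x + j * d < q → θ q s (a₀ + j * δ) ≡ x + j * d
    θ-walk j v<q = θ-≡ (j * e) (begin
      s * (a₀ + j * δ)       ≡⟨ *-distribˡ-+ s a₀ (j * δ) ⟩
      s * a₀ + s * (j * δ)   ≡⟨ cong (s * a₀ +_) (x*[y*z]≡y*[x*z] s j δ) ⟩
      s * a₀ + j * (s * δ)   ≡⟨ cong₂ (λ u v → u + j * v) s*a₀≡x s*δ≡d+eq ⟩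
      x + j * (d + e * q)    ≡⟨ cong (x +_) (x*[y+z*w]≡x*y+x*z*w j d e q) ⟩
      x + (j * d + j * e * q) ≡⟨ +-assoc x (j * d) (j * e * q) ⟨
      x + j * d + j * e * q  ∎) v<q
      where
      open ≡-Reasoning
      x*[y*z]≡y*[x*z] : ∀ k l n → k * (l * n) ≡ l * (k * n)
      x*[y*z]≡y*[x*z] k l n = solve (k ∷ l ∷ n ∷ [])
      x*[y+z*w]≡x*y+x*z*w : ∀ k l n o → k * (l + n * o) ≡ k * l + k * n * o
      x*[y+z*w]≡x*y+x*z*w k l n o = solve (k ∷ l ∷ n ∷ o ∷ [])

    eventually-above : ¬ (3 * (x + 2 * q * d) < 2 * q)
    eventually-above = ≤⇒≯ (begin
      2 * q                  ≤⟨ m≤m*n (2 * q) d {{>-nonZero 0<d}} ⟩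
      2 * q * d              ≤⟨ m≤n+m _ x ⟩
      x + 2 * q * d          ≤⟨ m≤n*m _ 3 ⟩
      3 * (x + 2 * q * d)    ∎)
      where open ≤-Reasoning

    large-at : ∀ j → x + j * d < q → 2 * q ≤ 3 * (x + j * d) → 2 * q ≤ 3 * θ q s (a₀ + j * δ)
    large-at j v<q = subst (λ v → 2 * q ≤ 3 * v) (sym (θ-walk j v<q))

    0<multiplier : ∀ j → 0 < a₀ + suc j * δ
    0<multiplier j = ≤-trans (p∤⇒0< p∤δ) (≤-trans (m≤m+n δ (j * δ)) (m≤n+m _ a₀))

    p∤next-multiplier : ∀ j → p ∣ a₀ + suc j * δ → ¬ p ∣ a₀ + suc (suc j) * δ
    p∤next-multiplier j p∣a p∣a′ =
      p∤δ (∣m+n∣m⇒∣n (subst (p ∣_) (next-multiplier a₀ j δ) p∣a′) p∣a)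
      where
      next-multiplier : ∀ k l n → k + suc (suc l) * n ≡ k + suc l * n + n
      next-multiplier k l n = solve (k ∷ l ∷ n ∷ [])

    values-grow : ∀ j → x + suc j * d ≤ x + suc (suc j) * d
    values-grow j = +-monoʳ-≤ x (*-monoˡ-≤ d (n≤1+n (suc j)))

    no-walk : ⊥
    no-walk with boundary (λ j → 3 * (x + j * d) <? 2 * q) (2 * q)
                   (subst (λ v → 3 * v < 2 * q) (sym (+-identityʳ x)) starts-below) eventually-above
    ... | j , below , ¬below with next j below | p ∣? (a₀ + suc j * δ)
    ... | v<q , 3a<q | no p∤a = small↛large p∤a 3a<q (large-at (suc j) v<q (≮⇒≥ ¬below))
    ... | _ | yes p∣a with next-next j below (p∣⇒5≤ (0<multiplier j) p∣a)
    ...   | v′<q , 3a′<q = small↛large (p∤next-multiplier j p∣a) 3a′<q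
                             (large-at (suc (suc j)) v′<q (≤-trans (≮⇒≥ ¬below) (*-monoʳ-≤ 3 (values-grow j))))

  multiples : 3 ≤ s → 3 * s < q → Walk
  multiples 3≤s 3s<q = record
    { a₀ = 0 ; δ = 1 ; x = 0 ; d = s ; e = 0
    ; s*a₀≡x = *-zeroʳ s
    ; s*δ≡d+eq = trans (*-identityʳ s) (sym (+-identityʳ s))
    ; p∤δ = p∤1
    ; 0<d = ≤-trans z<s 3≤s
    ; starts-below = ≤-trans (s≤s z≤n) (≤-trans 7≤q (m≤m+n q _))
    ; next = multiples-next 3≤s 3s<q
    ; next-next = multiples-next-next 3≤s 3s<q
    }

  odds : ∀ {t} → 3 ≤ t → s * 2 ≡ t + 1 * q → 3 * s < 2 * q → Walk
  odds {t} 3≤t s*2≡t+q 3s<2q = record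
    { a₀ = 1 ; δ = 2 ; x = s ; d = t ; e = 1
    ; s*a₀≡x = *-identityʳ s
    ; s*δ≡d+eq = s*2≡t+q
    ; p∤δ = p∤2
    ; 0<d = ≤-trans z<s 3≤t
    ; starts-below = 3s<2q
    ; next = odd-walk-next {q} {s} 3≤t s*2≡t+q
    ; next-next = odd-walk-next-next {q} {s} 3≤t s*2≡t+q
    }

  -- k = ⌊q/3⌋ and c = 4k − q: doubling sends k ↦ 2k ↦ c modulo q, along h-values 0, 1, 0.
  between-quarter-and-third : ∃[ k ] ∃[ c ]
    (¬ p ∣ k × ¬ p ∣ c × 4 * k ≡ c + q × 3 * k < q × q ≤ 3 * (2 * k) × 3 * (2 * k) < 2 * q × 3 * c < q)
  between-quarter-and-third with division-with-remainder q 3 3∤q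
  ... | k , e , q≡e+3k , 0<e , e<3 =
    k , k ∸ e , p∤k , p∤c , 4k≡c+q , 3k<q , q≤6k , 6k<2q , ≤-<-trans (*-monoʳ-≤ 3 (m∸n≤m k e)) 3k<q
    where
    open ≤-Reasoning
    e<k : e < k
    e<k = remainder<quotient k q≡e+3k (s≤s⁻¹ e<3) 7≤q 2∤q
    3k<q : 3 * k < q
    3k<q = subst (3 * k <_) (sym q≡e+3k) (m<n+m (3 * k) 0<e)
    4k≡c+q : 4 * k ≡ k ∸ e + q
    4k≡c+q = begin-equality
      4 * k                ≡⟨ solve (k ∷ []) ⟩
      k + 3 * k            ≡⟨ cong (_+ 3 * k) (m∸n+n≡m (<⇒≤ e<k)) ⟨
      k ∸ e + e + 3 * k    ≡⟨ +-assoc (k ∸ e) e (3 * k) ⟩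
      k ∸ e + (e + 3 * k)  ≡⟨ cong (k ∸ e +_) q≡e+3k ⟨
      k ∸ e + q            ∎
    q≤6k : q ≤ 3 * (2 * k)
    q≤6k = begin
      q            ≤⟨ m≤n+m q (k ∸ e) ⟩
      k ∸ e + q    ≡⟨ 4k≡c+q ⟨
      4 * k        ≤⟨ *-monoˡ-≤ k {4} {6} (s≤s (s≤s (s≤s (s≤s z≤n)))) ⟩
      6 * k        ≡⟨ *-assoc 3 2 k ⟩
      3 * (2 * k)  ∎
    6k<2q : 3 * (2 * k) < 2 * q
    6k<2q = begin-strict
      3 * (2 * k)  ≡⟨ solve (k ∷ []) ⟩
      2 * (3 * k)  <⟨ *-monoʳ-< 2 3k<q ⟩
      2 * q        ∎
    p∤k : ¬ p ∣ k
    p∤k p∣k = p∤small 0<e (≤-trans e<3 (s≤s (s≤s (s≤s z≤n))))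
                (∣m+n∣m⇒∣n (subst (p ∣_) (trans q≡e+3k (+-comm e (3 * k))) p∣q) (∣n⇒∣m*n 3 p∣k))
    p∤c : ¬ p ∣ k ∸ e
    p∤c p∣c with euclidsLemma 4 k p-prime (subst (p ∣_) (sym 4k≡c+q) (∣m∣n⇒∣m+n p∣c p∣q))
    ... | inj₁ p∣4 = p∤4 p∣4
    ... | inj₂ p∣k = p∤k p∣k

  identity-case : s ≡ 1 → ⊥
  identity-case s≡1 with half-is-middle {m = m} q≡1+2m (≤-trans (s≤s (s≤s (s≤s z≤n))) 7≤q)
  ... | q≤3m , 3m<2q = no-fixed-middle p∤m θm≡m q≤3m 3m<2q
    where
    θm≡m : θ q s m ≡ m
    θm≡m = θ-≡ 0 (cong (_* m) s≡1) (subst (m <_) (sym q≡1+2m) (s≤s (m≤n*m m 2)))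
    p∤m : ¬ p ∣ m
    p∤m p∣m = p∤1 (∣m+n∣m⇒∣n (subst (p ∣_) (trans q≡1+2m (+-comm 1 (2 * m))) p∣q) (∣n⇒∣m*n 2 p∣m))

  doubling-case : s ≡ 2 → ⊥
  doubling-case s≡2 with between-quarter-and-third
  ... | k , c , p∤k , _ , 4k≡c+q , 3k<q , q≤6k , 6k<2q , 3c<q =
    no-0-1-0-path p∤k (θ-≡ 0 s*k≡2k (3a<2q⇒a<q (2 * k) 6k<2q)) (θ-≡ 1 s*2k≡c+q (3a<q⇒a<q c 3c<q))
      3k<q q≤6k 6k<2q 3c<q
    where
    s*k≡2k : s * k ≡ 2 * k + 0 * q
    s*k≡2k = trans (cong (_* k) s≡2) (sym (+-identityʳ (2 * k)))
    s*2k≡c+q : s * (2 * k) ≡ c + 1 * q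
    s*2k≡c+q = begin
      s * (2 * k)  ≡⟨ cong (_* (2 * k)) s≡2 ⟩
      2 * (2 * k)  ≡⟨ *-assoc 2 2 k ⟨
      4 * k        ≡⟨ 4k≡c+q ⟩
      c + q        ≡⟨ cong (c +_) (*-identityˡ q) ⟨
      c + 1 * q    ∎
      where open ≡-Reasoning

  halving-case : s ≡ suc m → ⊥
  halving-case s≡1+m with between-quarter-and-third
  ... | k , c , _ , p∤c , 4k≡c+q , 3k<q , q≤6k , 6k<2q , 3c<q =
    no-0-1-0-path p∤c θc≡2k θ2k≡k 3c<q q≤6k 6k<2q 3k<q
    where
    θ2k≡k : θ q s (2 * k) ≡ k
    θ2k≡k = θ-≡ k (halving-double {m = m} k q≡1+2m s≡1+m) (3a<q⇒a<q k 3k<q)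
    θc≡2k : θ q s c ≡ 2 * k
    θc≡2k = begin
      (s * c) % q                ≡⟨ [m+kn]%n≡m%n (s * c) s q ⟨
      (s * c + s * q) % q        ≡⟨ %-of-≡ (2 * k) (halving-shift {k = k} q≡1+2m s≡1+m 4k≡c+q)
                                             (3a<2q⇒a<q (2 * k) 6k<2q) ⟩
      2 * k                      ∎
      where open ≡-Reasoning

  large-multiplier : 2 * q ≤ 3 * s → ⊥
  large-multiplier 2q≤3s =
    small↛large p∤1 (≤-trans (s≤s (s≤s (s≤s (s≤s z≤n)))) 7≤q)
      (subst (λ v → 2 * q ≤ 3 * v) (sym θ1≡s) 2q≤3s)
    where
    θ1≡s : θ q s 1 ≡ s
    θ1≡s = θ-≡ 0 (trans (*-identityʳ s) (sym (+-identityʳ s))) s<q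

  small-multiplier : 3 * s < q → ⊥
  small-multiplier 3s<q with s ≟ 1 | s ≟ 2
  ... | yes s≡1 | _ = identity-case s≡1
  ... | no _ | yes s≡2 = doubling-case s≡2
  ... | no s≢1 | no s≢2 = no-walk (multiples 3≤s 3s<q)
    where
    3≤s : 3 ≤ s
    3≤s = ≤∧≢⇒< (≤∧≢⇒< (p∤⇒0< p∤s) (s≢1 ∘ sym)) (s≢2 ∘ sym)

  doubled-multiplier : q ≤ 3 * s → s * 2 < q → ⊥
  doubled-multiplier q≤3s 2s<q =
    small↛large p∤2 7≤q (subst (λ v → 2 * q ≤ 3 * v) (sym θ2≡2s) 2q≤6s)
    where
    θ2≡2s : θ q s 2 ≡ s * 2
    θ2≡2s = θ-≡ 0 (sym (+-identityʳ (s * 2))) 2s<q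
    2q≤6s : 2 * q ≤ 3 * (s * 2)
    2q≤6s = begin
      2 * q        ≤⟨ *-monoʳ-≤ 2 q≤3s ⟩
      2 * (3 * s)  ≡⟨ solve (s ∷ []) ⟩
      3 * (s * 2)  ∎
      where open ≤-Reasoning

  middle-multiplier : q ≤ 3 * s → 3 * s < 2 * q → ⊥
  middle-multiplier q≤3s 3s<2q with s * 2 <? q | s ≟ suc m
  ... | yes 2s<q | _       = doubled-multiplier q≤3s 2s<q
  ... | no _ | yes s≡1+m  = halving-case s≡1+m
  ... | no 2s≮q | no s≢1+m with above-half {m = m} q≡1+2m (≮⇒≥ 2s≮q) s≢1+m
  ...   | t , 3≤t , s*2≡t+q = no-walk (odds 3≤t s*2≡t+q 3s<2q)

  no-splitting : ⊥
  no-splitting with 2 * q ≤? 3 * s | 3 * s <? q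
  ... | yes large | _          = large-multiplier large
  ... | no _      | yes small  = small-multiplier small
  ... | no ¬large | no ¬small  = middle-multiplier (≮⇒≥ ¬small) (≰⇒> ¬large)

lemma5p9 : (q : ℕ) → .{{_ : NonZero q}} → IsAdmissiblePrimePower q → q ≢ 5 →
    ¬ (Σ[ g ∈ (ℕ → Bool) ] (((a : ℕ) → IsUnit q a → bit (g a) + bit (g (neg q a)) ≡ 1)
      × Σ[ s ∈ ℕ ] (IsUnit q s × ((a : ℕ) → IsUnit q a → h q a ≡ bit (g a) + bit (g (θ q s a))))))
lemma5p9 q (p , r , p-prime , 2∤p , p≢3 , 0<r , q≡p^r) q≢5 (g , _ , s , (_ , s<q , s⊥q) , split) =
  no-splitting q p p-prime 5≤p p∣q coprime q≢5 g s p∤s s<q split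
  where
  5≤p : 5 ≤ p
  5≤p = ≤∧≢⇒< (≤∧≢⇒< (≤∧≢⇒< (nonTrivial⇒n>1 p {{prime⇒nonTrivial p-prime}})
                                (λ 2≡p → 2∤p (∣-reflexive 2≡p)))
                        (p≢3 ∘ sym))
               (λ 4≡p → 2∤p (subst (2 ∣_) 4≡p (divides 2 refl)))
  p∣q : p ∣ q
  p∣q = subst (p ∣_) (sym q≡p^r) (m∣m^n 0<r)
  coprime : ∀ {a} → ¬ p ∣ a → Coprime a q
  coprime p∤a = subst (Coprime _) (sym q≡p^r) (coprime-^ r (prime∤⇒coprime p-prime p∤a))
  p∤s : ¬ p ∣ s
  p∤s p∣s = <⇒≱ (nonTrivial⇒n>1 p {{prime⇒nonTrivial p-prime}}) (≤-reflexive (s⊥q (p∣s , p∣q)))
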